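{- Let $k$ be a positive integer, let $(G,x,y)$ be a $2$-connected rooted graph, let $l$ be an integer and let $H=G[S,T]$ be an $l$-core of $G$ with respect to $(x,y)$. Let $C$ be the component of $G-V(H)$ containing $y$. If $l=k-1$, $E_G(S\setminus\{x\},V(C))\neq\emptyset$ and $E(G[T])\neq\emptyset$, then $G$ contains $k$ paths from $x$ to $y$ satisfying the semi-length condition.
   Context: All graphs are finite and simple. A rooted graph $(G,x,y)$ ($x\ne y$ vertices of $G$) is $2$-connected if $G$ is connected of order at least $3$ with at most two end blocks and every end block of $G$ contains at least one of $x,y$ as a non-cut vertex. For disjoint $S,T\subseteq V(G)$, $E_G(S,T)$ is the set of edges between $S$ and $T$, $e_G(S,T)=|E_G(S,T)|$, and $G[S,T]$ is the bipartite graph with vertex set $S\cup T$, edge set $E_G(S,T)$ and partite sets $S,T$; $G[T]$ is the subgraph induced by $T$. A bipartite subgraph $H=G[S,T]$ is an $l$-core with respect to $(x,y)$ if (C1) $H$ is complete bipartite and $|T|\ge|S|=l+1\ge 2$; (C2) $x\in S$ and $y\notin V(H)$; (C3) $e_G(v,S)\le l$ for every $v\in V(G)\setminus(V(H)\cup\{y\})$; (C4) $e_G(v,T\setminus\{v\})\le l+1$ for every $v\in V(G)\setminus(S\cup\{y\})$. A sequence of paths $H_1,\dots,H_k$ satisfies the semi-length condition if $|E(H_1)|\ge 2$ and there is an index $j$ with $1\le j\le k-1$ such that $|E(H_{i+1})|-|E(H_i)|=2$ for $1\le i\le j-1$, $|E(H_{j+1})|-|E(H_j)|=1$, and $|E(H_{i+1})|-|E(H_i)|=2$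 for $j+1\le i\le k-1$. -}

module Defs where

open import Data.Nat using (ℕ; zero; suc; _+_; _∸_; _≤_; _<_; _<?_)
open import Data.Fin using (Fin; fromℕ; fromℕ<; inject₁) renaming (zero to fz; suc to fs)
open import Data.Fin.Subset using (Subset; _∈_; _∉_; _⊆_; _∩_; _∪_; _-_; ∁; ∣_∣)
  renaming (⊤ to all)
open import Data.Bool using (Bool; true; false)
open import Data.Vec using (tabulate)
open import Data.Product using (Σ; _×_; ∃)
open import Data.Sum using (_⊎_)
open import Relation.Nullary using (¬_; yes; no)
open import Relation.Binary.PropositionalEquality using (_≡_)
open import Function.Definitions using (Injective)

record Graph (n : ℕ) : Set where
  field
    adj   : Fin n → Fin n → Bool
    sym   : ∀ u v → adj u v ≡ adj v u
    irrefl : ∀ v → adj v v ≡ false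

module _ {n : ℕ} (G : Graph n) where
  open Graph G

  Edge : Fin n → Fin n → Set
  Edge u v = adj u v ≡ true

  N : Fin n → Subset n
  N v = tabulate (adj v)

  eVS : Fin n → Subset n → ℕ
  eVS v S = ∣ N v ∩ S ∣

  data Reach (U : Subset n) (a : Fin n) : Fin n → Set where
    here : a ∈ U → Reach U a a
    step : ∀ {c d} → Reach U a c → Edge c d → d ∈ U → Reach U a d

  -- G[U] is connected (the empty set counts as connected)
  Connected : Subset n → Set
  Connected U = ∀ a b → a ∈ U → b ∈ U → Reach U a b

  IsCut : Fin n → Set
  IsCut v = ¬ Connected (all - v)

  Nonsep : Subset n → Set
  Nonsep U = Connected U × (∀ v → v ∈ U → Connected (U - v))

  -- blocks: maximal connected subgraphs without a cut vertex (given by vertex sets;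
  -- blocks are induced subgraphs)
  IsBlock : Subset n → Set
  IsBlock B = Nonsep B × (∀ B′ → B ⊆ B′ → Nonsep B′ → B′ ≡ B)

  IsEndBlock : Subset n → Set
  IsEndBlock B = IsBlock B × (∀ u v → u ∈ B → v ∈ B → IsCut u → IsCut v → u ≡ v)

  TwoConnRooted : Fin n → Fin n → Set
  TwoConnRooted x y =
    ¬ (x ≡ y) × Connected all × 3 ≤ n
    × (∀ B₁ B₂ B₃ → IsEndBlock B₁ → IsEndBlock B₂ → IsEndBlock B₃ →
         (B₁ ≡ B₂) ⊎ (B₁ ≡ B₃) ⊎ (B₂ ≡ B₃))
    × (∀ B → IsEndBlock B → (x ∈ B × ¬ IsCut x) ⊎ (y ∈ B × ¬ IsCut y))

  IsCore : ℕ → Subset n → Subset n → Fin n → Fin n → Set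
  IsCore l S T x y =
    (∀ v → v ∈ S → v ∉ T)
    -- (C1)
    × (∀ s t → s ∈ S → t ∈ T → Edge s t)
    × ∣ S ∣ ≡ suc l × 2 ≤ suc l × ∣ S ∣ ≤ ∣ T ∣
    -- (C2)
    × x ∈ S × y ∉ S × y ∉ T
    -- (C3)
    × (∀ v → v ∉ S → v ∉ T → ¬ (v ≡ y) → eVS v S ≤ l)
    -- (C4)
    × (∀ v → v ∉ S → ¬ (v ≡ y) → eVS v (T - v) ≤ suc l)

  record Path (x y : Fin n) : Set where
    field
      len   : ℕ
      vtx   : Fin (suc len) → Fin n
      inj   : Injective _≡_ _≡_ vtx
      start : vtx fz ≡ x
      end   : vtx (fromℕ len) ≡ y
      edges : ∀ (i : Fin len) → Edge (vtx (inject₁ i)) (vtx (fs i))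

-- extend a Fin k-indexed family of numbers to a 1-indexed ℕ-indexed one:
-- ext f i = f (i - 1) for 1 ≤ i ≤ k, and 0 otherwise
ext : {k : ℕ} → (Fin k → ℕ) → ℕ → ℕ
ext f zero = 0
ext {k} f (suc i) with i <? k
... | yes p = f (fromℕ< p)
... | no _  = 0

-- semi-length condition for a sequence of lengths L 1, ..., L k (1-indexed)
SemiLengthℕ : ℕ → (ℕ → ℕ) → Set
SemiLengthℕ k L =
  2 ≤ L 1 ×
  Σ ℕ λ j → 1 ≤ j × j ≤ k ∸ 1
    × (∀ i → 1 ≤ i → i ≤ j ∸ 1 → L (suc i) ≡ L i + 2)
    × L (suc j) ≡ L j + 1
    × (∀ i → suc j ≤ i → i ≤ k ∸ 1 → L (suc i) ≡ L i + 2)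

-- the sequence of paths H₁, ..., H_k (H (i-1) is H_i) satisfies the semi-length condition
SemiLength : {n : ℕ} {G : Graph n} {x y : Fin n} (k : ℕ) → (Fin k → Path G x y) → Set
SemiLength k H = SemiLengthℕ k (ext (λ i → Path.len (H i)))

module Submission where

-- From the hypotheses pick
--   * s ∈ S ∖ {x} with a neighbour c in the component C of G - V(H) containing y,
--     and a path P from c to y inside C (obtained by shortening a walk);
--   * an edge tt′ of G[T].
-- Since G[S,T] is complete bipartite we may alternate between S and T freely.
-- With a₁, …, a_{l-1} ∈ S ∖ {x, s} and b₁, …, b_{l-1} ∈ T ∖ {t, t′} (they exist
-- as |S| = l + 1 ≤ |T|), the paths
--     H₁     = x t s P                          (length |P| + 3)
--     H_{m+2} = x t t′ a₁ b₁ … a_m b_m s P      (length |P| + 4 + 2m), 0 ≤ m ≤ l - 1,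
-- are k = l + 1 paths from x to y whose lengths increase by 1 and then by 2,
-- i.e. they satisfy the semi-length condition with j = 1.
-- The file first develops generic facts about duplicate-free lists of vertices
-- (which become paths once consecutive entries are adjacent), about walks and
-- about the semi-length condition; the module Construction then assembles the
-- paths, and lemma2 merely unpacks the hypotheses.

open import Defs
open import Data.Nat using (ℕ; zero; suc; _+_; _∸_; _≤_; _<_; _<?_; z≤n; s≤s)
open import Data.Nat.Properties using (≤-refl; ≤-trans; ≤-pred; <⇒≤; +-comm; +-suc)
open import Data.Nat.Tactic.RingSolver using (solve-∀)
open import Data.Fin using (Fin; toℕ; fromℕ; fromℕ<; inject₁; _≟_) renaming (zero to fz; suc to fs)
open import Data.Fin.Properties using (toℕ-fromℕ<) renaming (suc-injective to fs-injective)
open import Data.Fin.Subset using (Subset; _∈_; _∉_; _∪_; ∁; ∣_∣)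
open import Data.Fin.Subset.Properties using (x∈∁p⇒x∉p; x∈p∪q⁺)
open import Data.Vec.Base using (here; there)
import Data.Vec.Base as Vec
open import Data.Bool using (true; false)
open import Data.Product using (Σ; _×_; _,_; proj₁)
open import Data.Sum using (_⊎_; inj₁; inj₂)
open import Data.Unit using (⊤; tt)
open import Data.Empty using (⊥-elim)
open import Data.List using (List; []; _∷_; _++_; length; map; lookup)
open import Data.List.Properties using (length-++; length-map)
open import Data.List.Relation.Unary.All using (All; []; _∷_) renaming (map to All-map; zip to All-zip; universal to All-universal)
open import Data.List.Relation.Unary.All.Properties using (¬Any⇒All¬) renaming (++⁺ to All-++; map⁺ to All-map⁺)
open import Data.List.Relation.Unary.Any using (Any; here; there; any?)
open import Data.List.Relation.Unary.AllPairs using ([]; _∷_)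
open import Data.List.Relation.Unary.Unique.Propositional using (Unique)
open import Data.List.Relation.Unary.Unique.Propositional.Properties using () renaming (map⁺ to Unique-map)
open import Relation.Nullary using (¬_; yes; no)
open import Relation.Binary.Definitions using (DecidableEquality)
open import Relation.Binary.PropositionalEquality using (_≡_; _≢_; refl; sym; trans; cong; subst; module ≡-Reasoning)


module _ {A : Set} where

  lastOf : A → List A → A
  lastOf u []       = u
  lastOf u (v ∷ vs) = lastOf v vs

  lastOf-++ : ∀ u xs v ys → lastOf u (xs ++ v ∷ ys) ≡ lastOf v ys
  lastOf-++ u []       v ys = refl
  lastOf-++ u (w ∷ xs) v ys = lastOf-++ w xs v ys

  lookup-last : ∀ u vs → lookup (u ∷ vs) (fromℕ (length vs)) ≡ lastOf u vs
  lookup-last u []       = refl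
  lookup-last u (v ∷ vs) = lookup-last v vs

  All-lookup : ∀ {P : A → Set} xs → All P xs → ∀ i → P (lookup xs i)
  All-lookup (_ ∷ _)  (p ∷ _)  fz     = p
  All-lookup (_ ∷ xs) (_ ∷ ps) (fs i) = All-lookup xs ps i

  lookup-injective : ∀ (xs : List A) → Unique xs → ∀ i j → lookup xs i ≡ lookup xs j → i ≡ j
  lookup-injective (u ∷ xs) _           fz     fz     _ = refl
  lookup-injective (u ∷ xs) (u∉xs ∷ _)  fz     (fs j) e = ⊥-elim (All-lookup xs u∉xs j e)
  lookup-injective (u ∷ xs) (u∉xs ∷ _)  (fs i) fz     e = ⊥-elim (All-lookup xs u∉xs i (sym e))
  lookup-injective (u ∷ xs) (_ ∷ uq)    (fs i) (fs j) e = cong fs (lookup-injective xs uq i j e)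

  avoids : ∀ {P Q : A → Set} {a ys} → (∀ {v} → P v → ¬ Q v) → P a → All Q ys → All (a ≢_) ys
  avoids {Q = Q} P⇒¬Q pa qs = All-map (λ qb a≡b → P⇒¬Q pa (subst Q (sym a≡b) qb)) qs

  separated : ∀ {P Q : A → Set} {xs ys} → (∀ {v} → P v → ¬ Q v) →
              All P xs → All Q ys → All (λ a → All (a ≢_) ys) xs
  separated P⇒¬Q ps qs = All-map (λ pa → avoids P⇒¬Q pa qs) ps

  ++-unique : ∀ {xs ys : List A} → Unique xs → Unique ys → All (λ a → All (a ≢_) ys) xs → Unique (xs ++ ys)
  ++-unique []           uys _             = uys
  ++-unique (a∉xs ∷ uxs) uys (a∉ys ∷ rest) = All-++ a∉xs a∉ys ∷ ++-unique uxs uys rest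

  zigzag : ℕ → List A → List A → List A
  zigzag zero    _        _        = []
  zigzag (suc m) []       _        = []
  zigzag (suc m) (a ∷ as) []       = []
  zigzag (suc m) (a ∷ as) (b ∷ bs) = a ∷ b ∷ zigzag m as bs

  zigzag-All : ∀ {P : A → Set} m {as bs} → All P as → All P bs → All P (zigzag m as bs)
  zigzag-All zero    _        _        = []
  zigzag-All (suc m) []       _        = []
  zigzag-All (suc m) (_ ∷ _)  []       = []
  zigzag-All (suc m) (p ∷ ps) (q ∷ qs) = p ∷ q ∷ zigzag-All m ps qs

  length-zigzag : ∀ m (as bs : List A) → m ≤ length as → m ≤ length bs →
                  length (zigzag m as bs) ≡ m + m
  length-zigzag zero    _        _        _         _         = refl
  length-zigzag (suc m) (a ∷ as) (b ∷ bs) (s≤s m≤as) (s≤s m≤bs) =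
    trans (cong (λ k → suc (suc k)) (length-zigzag m as bs m≤as m≤bs)) (sym (cong suc (+-suc m m)))

  zigzag-unique : ∀ {P Q : A → Set} → (∀ {v} → P v → ¬ Q v) → ∀ m {as bs} →
                  Unique as → Unique bs → All P as → All Q bs → Unique (zigzag m as bs)
  zigzag-unique P⇒¬Q zero    _            _            _          _          = []
  zigzag-unique P⇒¬Q (suc m) []           _            _          _          = []
  zigzag-unique P⇒¬Q (suc m) (_ ∷ _)      []           _          _          = []
  zigzag-unique P⇒¬Q (suc m) {a ∷ as} {b ∷ bs} (a∉as ∷ uas) (b∉bs ∷ ubs) (pa ∷ pas) (qb ∷ qbs)
    with avoids P⇒¬Q pa (qb ∷ qbs) | avoids (λ qv pv → P⇒¬Q pv qv) qb pas
  ... | a≢b ∷ a∉bs | b∉as =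
    (a≢b ∷ zigzag-All m a∉as a∉bs) ∷ (zigzag-All m b∉as b∉bs ∷ zigzag-unique P⇒¬Q m uas ubs pas qbs)

-- Deleting the first occurrence of an entry; on a duplicate-free list this removes
-- the entry entirely and shortens the list by at most one.
module _ {A : Set} (_≟ᴬ_ : DecidableEquality A) where

  delete : A → List A → List A
  delete v [] = []
  delete v (u ∷ us) with u ≟ᴬ v
  ... | yes _ = us
  ... | no  _ = u ∷ delete v us

  delete-length : ∀ v us → length us ≤ suc (length (delete v us))
  delete-length v [] = z≤n
  delete-length v (u ∷ us) with u ≟ᴬ v
  ... | yes _ = ≤-refl
  ... | no  _ = s≤s (delete-length v us)

  delete-All : ∀ {P : A → Set} v us → All P us → All P (delete v us)
  delete-All v []       ps       = ps
  delete-All v (u ∷ us) (p ∷ ps) with u ≟ᴬ v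
  ... | yes _ = ps
  ... | no  _ = p ∷ delete-All v us ps

  delete-unique : ∀ v us → Unique us → Unique (delete v us)
  delete-unique v []       uq          = uq
  delete-unique v (u ∷ us) (u∉us ∷ uq) with u ≟ᴬ v
  ... | yes _ = uq
  ... | no  _ = delete-All v us u∉us ∷ delete-unique v us uq

  delete-removes : ∀ v us → Unique us → All (_≢ v) (delete v us)
  delete-removes v []       _           = []
  delete-removes v (u ∷ us) (u∉us ∷ uq) with u ≟ᴬ v
  ... | yes refl = All-map (λ u≢w w≡u → u≢w (sym w≡u)) u∉us
  ... | no  u≢v  = u≢v ∷ delete-removes v us uq

elements : ∀ {n} → Subset n → List (Fin n)
elements Vec.[]            = []
elements (true  Vec.∷ U) = fz ∷ map fs (elements U)
elements (false Vec.∷ U) = map fs (elements U)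

length-elements : ∀ {n} (U : Subset n) → length (elements U) ≡ ∣ U ∣
length-elements Vec.[]          = refl
length-elements (true  Vec.∷ U) = cong suc (trans (length-map fs (elements U)) (length-elements U))
length-elements (false Vec.∷ U) = trans (length-map fs (elements U)) (length-elements U)

elements-∈ : ∀ {n} (U : Subset n) → All (_∈ U) (elements U)
elements-∈ Vec.[]          = []
elements-∈ (true  Vec.∷ U) = here ∷ All-map⁺ (All-map there (elements-∈ U))
elements-∈ (false Vec.∷ U) = All-map⁺ (All-map there (elements-∈ U))

elements-unique : ∀ {n} (U : Subset n) → Unique (elements U)
elements-unique Vec.[]          = []
elements-unique (true  Vec.∷ U) =
  All-map⁺ (All-universal (λ _ ()) (elements U)) ∷ Unique-map fs-injective (elements-unique U)
elements-unique (false Vec.∷ U) = Unique-map fs-injective (elements-unique U)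

record Listing {n} (U : Subset n) (u v : Fin n) : Set where
  field
    entries : List (Fin n)
    unique  : Unique entries
    members : All (λ w → w ∈ U × w ≢ u × w ≢ v) entries
    large   : ∣ U ∣ ≤ suc (suc (length entries))

listing : ∀ {n} (U : Subset n) (u v : Fin n) → Listing U u v
listing U u v = record
  { entries = delete _≟_ v U∖u
  ; unique  = delete-unique _≟_ v U∖u (delete-unique _≟_ u (elements U) (elements-unique U))
  ; members = All-zip
      ( delete-All _≟_ v U∖u (delete-All _≟_ u (elements U) (elements-∈ U))
      , All-zip
          ( delete-All _≟_ v U∖u (delete-removes _≟_ u (elements U) (elements-unique U))
          , delete-removes _≟_ v U∖u (delete-unique _≟_ u (elements U) (elements-unique U))))
  ; large   = subst (_≤ suc (suc (length (delete _≟_ v U∖u)))) (length-elements U)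
      (≤-trans (delete-length _≟_ u (elements U)) (s≤s (delete-length _≟_ v U∖u)))
  }
  where
  U∖u : List _
  U∖u = delete _≟_ u (elements U)

module _ {n : ℕ} (G : Graph n) where

  Edge-sym : ∀ {u v} → Edge G u v → Edge G v u
  Edge-sym {u} {v} uv = trans (Graph.sym G v u) uv

  Chain : Fin n → List (Fin n) → Set
  Chain u []       = ⊤
  Chain u (v ∷ vs) = Edge G u v × Chain v vs

  chain-edges : ∀ u vs → Chain u vs →
                ∀ i → Edge G (lookup (u ∷ vs) (inject₁ i)) (lookup (u ∷ vs) (fs i))
  chain-edges u (v ∷ vs) (uv , _)  fz     = uv
  chain-edges u (v ∷ vs) (_ , ch) (fs i) = chain-edges v vs ch i

  toPath : ∀ x y vs → Chain x vs → Unique (x ∷ vs) → lastOf x vs ≡ y → Path G x y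
  toPath x y vs ch uq last = record
    { len   = length vs
    ; vtx   = lookup (x ∷ vs)
    ; inj   = λ {i} {j} → lookup-injective (x ∷ vs) uq i j
    ; start = refl
    ; end   = trans (lookup-last x vs) last
    ; edges = chain-edges x vs ch
    }

  record PathIn (U : Subset n) (u y : Fin n) : Set where
    field
      rest    : List (Fin n)
      chain   : Chain u rest
      unique  : Unique (u ∷ rest)
      inside  : All (_∈ U) (u ∷ rest)
      last    : lastOf u rest ≡ y

  suffix : ∀ {U u y w} (π : PathIn U u y) → Any (w ≡_) (u ∷ PathIn.rest π) → PathIn U w y
  suffix π (here refl) = π
  suffix record { rest = _ ∷ rest ; chain = _ , ch ; unique = _ ∷ uq ; inside = _ ∷ ins ; last = last }
         (there w∈rest) =
    suffix (record { rest = rest ; chain = ch ; unique = uq ; inside = ins ; last = last }) w∈rest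

  prepend : ∀ {U u y w} (π : PathIn U u y) → Edge G w u → w ∈ U →
            ¬ Any (w ≡_) (u ∷ PathIn.rest π) → PathIn U w y
  prepend {u = u} π wu w∈U w∉π = record
    { rest   = u ∷ PathIn.rest π
    ; chain  = wu , PathIn.chain π
    ; unique = ¬Any⇒All¬ (u ∷ PathIn.rest π) w∉π ∷ PathIn.unique π
    ; inside = w∈U ∷ PathIn.inside π
    ; last   = PathIn.last π
    }

  -- Every walk inside U contains a path inside U between the same ends: a walk from
  -- y to c is read backwards, cutting out a cycle whenever it revisits a vertex.
  reach⇒path : ∀ {U y c} → Reach G U y c → PathIn U c y
  reach⇒path (here y∈U) = record
    { rest = [] ; chain = tt ; unique = [] ∷ [] ; inside = y∈U ∷ [] ; last = refl }
  reach⇒path (step {c} {d} walk cd d∈U) with reach⇒path walk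
  ... | π with any? (d ≟_) (c ∷ PathIn.rest π)
  ... | yes d∈π = suffix π d∈π
  ... | no  d∉π = prepend π (Edge-sym cd) d∈U d∉π

ext-fromℕ< : ∀ {k} (f : Fin k → ℕ) i (i<k : i < k) → ext f (suc i) ≡ f (fromℕ< i<k)
ext-fromℕ< {k} f i i<k with i <? k
... | yes _   = refl
... | no  i≮k = ⊥-elim (i≮k i<k)

semiLength-at-1 : ∀ k (L : ℕ → ℕ) → 2 ≤ k → 2 ≤ L 1 → L 2 ≡ L 1 + 1 →
                  (∀ i → 2 ≤ i → i ≤ k ∸ 1 → L (suc i) ≡ L i + 2) → SemiLengthℕ k L
semiLength-at-1 (suc (suc k)) L (s≤s (s≤s z≤n)) 2≤L₁ L₂≡L₁+1 steps-by-2 =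
  2≤L₁ , 1 , ≤-refl , s≤s z≤n , (λ { (suc i) _ () }) , L₂≡L₁+1 , steps-by-2

module Construction {n : ℕ} (G : Graph n) (x y : Fin n) (l : ℕ) (S T : Subset n)
  (S∩T=∅ : ∀ v → v ∈ S → v ∉ T)
  (complete : ∀ u v → u ∈ S → v ∈ T → Edge G u v)
  (|S|≡l+1 : ∣ S ∣ ≡ suc l) (|S|≤|T| : ∣ S ∣ ≤ ∣ T ∣) (x∈S : x ∈ S)
  (s c : Fin n) (s∈S : s ∈ S) (s≢x : s ≢ x) (y⇝c : Reach G (∁ (S ∪ T)) y c) (sc : Edge G s c)
  (t t′ : Fin n) (t∈T : t ∈ T) (t′∈T : t′ ∈ T) (tt′ : Edge G t t′) where

  S-T-distinct : ∀ {u v} → u ∈ S → v ∈ T → u ≢ v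
  S-T-distinct {u} u∈S v∈T u≡v = S∩T=∅ u u∈S (subst (_∈ T) (sym u≡v) v∈T)

  Outside : Fin n → Set
  Outside v = v ∉ S × v ∉ T

  outside : ∀ {v} → v ∈ ∁ (S ∪ T) → Outside v
  outside v∈C = (λ v∈S → x∈∁p⇒x∉p v∈C (x∈p∪q⁺ (inj₁ v∈S))) , (λ v∈T → x∈∁p⇒x∉p v∈C (x∈p∪q⁺ (inj₂ v∈T)))

  P : PathIn G (∁ (S ∪ T)) c y
  P = reach⇒path G y⇝c

  exit : List (Fin n)
  exit = s ∷ c ∷ PathIn.rest P

  Exit : Fin n → Set
  Exit v = v ≡ s ⊎ Outside v

  exit-classes : All Exit exit
  exit-classes = inj₁ refl ∷ All-map (λ v∈C → inj₂ (outside v∈C)) (PathIn.inside P)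

  exit-unique : Unique exit
  exit-unique = All-map (λ v∈C s≡v → proj₁ (outside v∈C) (subst (_∈ S) s≡v s∈S)) (PathIn.inside P)
              ∷ PathIn.unique P

  As : Listing S x s
  As = listing S x s

  Bs : Listing T t t′
  Bs = listing T t t′

  as bs : List (Fin n)
  as = Listing.entries As
  bs = Listing.entries Bs

  enough : ∀ {U : Subset n} {u v : Fin n} (L : Listing U u v) → ∣ S ∣ ≤ ∣ U ∣ →
           ∀ m → m < l → m ≤ length (Listing.entries L)
  enough L |S|≤|U| m m<l = ≤-pred (≤-pred (≤-trans m+2≤|S| (≤-trans |S|≤|U| (Listing.large L))))
    where
    m+2≤|S| : suc (suc m) ≤ ∣ S ∣
    m+2≤|S| = subst (suc (suc m) ≤_) (sym |S|≡l+1) (s≤s m<l)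

  W : ℕ → List (Fin n)
  W m = zigzag m as bs ++ exit

  -- Entered from a vertex of T, W m is a walk, since G[S,T] is complete.
  W-chain : ∀ m {u} → u ∈ T → Chain G u (W m)
  W-chain m u∈T = alternate m u∈T (All-map proj₁ (Listing.members As)) (All-map proj₁ (Listing.members Bs))
    where
    alternate : ∀ m {u as bs} → u ∈ T → All (_∈ S) as → All (_∈ T) bs → Chain G u (zigzag m as bs ++ exit)
    alternate zero    u∈T _          _          = Edge-sym G (complete s _ s∈S u∈T) , sc , PathIn.chain P
    alternate (suc m) u∈T []         _          = Edge-sym G (complete s _ s∈S u∈T) , sc , PathIn.chain P
    alternate (suc m) u∈T (_ ∷ _)    []         = Edge-sym G (complete s _ s∈S u∈T) , sc , PathIn.chain P
    alternate (suc m) u∈T (a∈S ∷ as) (b∈T ∷ bs) =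
      Edge-sym G (complete _ _ a∈S u∈T) , complete _ _ a∈S b∈T , alternate m b∈T as bs

  W-last : ∀ m u → lastOf u (W m) ≡ y
  W-last m u = trans (lastOf-++ u (zigzag m as bs) s (c ∷ PathIn.rest P)) (PathIn.last P)

  W-unique : ∀ m → Unique (W m)
  W-unique m = ++-unique
    (zigzag-unique (λ {v} v∈S v∈T → S∩T=∅ v v∈S v∈T) m (Listing.unique As) (Listing.unique Bs)
      (All-map proj₁ (Listing.members As)) (All-map proj₁ (Listing.members Bs)))
    exit-unique
    (separated zig∉exit
      (zigzag-All m (All-map (λ (v∈S , _ , v≢s) → inj₁ (v∈S , v≢s)) (Listing.members As))
                    (All-map (λ (v∈T , _) → inj₂ v∈T) (Listing.members Bs)))
      exit-classes)
    where
    zig∉exit : ∀ {v} → (v ∈ S × v ≢ s) ⊎ v ∈ T → ¬ Exit v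
    zig∉exit (inj₁ (_ , v≢s)) (inj₁ v≡s)         = v≢s v≡s
    zig∉exit (inj₁ (v∈S , _)) (inj₂ (v∉S , _))   = v∉S v∈S
    zig∉exit (inj₂ v∈T)       (inj₁ refl)        = S∩T=∅ s s∈S v∈T
    zig∉exit (inj₂ v∈T)       (inj₂ (_ , v∉T))   = v∉T v∈T

  -- The vertices of W m, classified so that x, t and t′ visibly avoid them.
  data Inner (v : Fin n) : Set where
    inS : v ∈ S → v ≢ x → Inner v
    inT : v ∈ T → v ≢ t → v ≢ t′ → Inner v
    out : Outside v → Inner v

  W-inner : ∀ m → All Inner (W m)
  W-inner m = All-++
    (zigzag-All m (All-map (λ (v∈S , v≢x , _) → inS v∈S v≢x) (Listing.members As))
                  (All-map (λ (v∈T , v≢t , v≢t′) → inT v∈T v≢t v≢t′) (Listing.members Bs)))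
    (inS s∈S s≢x ∷ All-map (λ v∈C → out (outside v∈C)) (PathIn.inside P))

  x-avoids : ∀ {v} → Inner v → x ≢ v
  x-avoids (inS _ v≢x)     x≡v = v≢x (sym x≡v)
  x-avoids (inT v∈T _ _)       = S-T-distinct x∈S v∈T
  x-avoids (out (v∉S , _)) x≡v = v∉S (subst (_∈ S) x≡v x∈S)

  T-end-avoids : ∀ {u v} → u ≡ t ⊎ u ≡ t′ → Inner v → u ≢ v
  T-end-avoids (inj₁ refl) (inS v∈S _)     u≡v = S-T-distinct v∈S t∈T (sym u≡v)
  T-end-avoids (inj₂ refl) (inS v∈S _)     u≡v = S-T-distinct v∈S t′∈T (sym u≡v)
  T-end-avoids (inj₁ refl) (inT _ v≢t _)   u≡v = v≢t (sym u≡v)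
  T-end-avoids (inj₂ refl) (inT _ _ v≢t′)  u≡v = v≢t′ (sym u≡v)
  T-end-avoids (inj₁ refl) (out (_ , v∉T)) u≡v = v∉T (subst (_∈ T) u≡v t∈T)
  T-end-avoids (inj₂ refl) (out (_ , v∉T)) u≡v = v∉T (subst (_∈ T) u≡v t′∈T)

  t≢t′ : t ≢ t′
  t≢t′ refl with trans (sym (Graph.irrefl G t)) tt′
  ... | ()

  direct : Path G x y
  direct = toPath G x y (t ∷ W 0) (complete x t x∈S t∈T , W-chain 0 t∈T)
    ( (S-T-distinct x∈S t∈T ∷ All-map x-avoids (W-inner 0))
    ∷ (All-map (T-end-avoids (inj₁ refl)) (W-inner 0) ∷ W-unique 0))
    (W-last 0 t)

  detour : ℕ → Path G x y
  detour m = toPath G x y (t ∷ t′ ∷ W m) (complete x t x∈S t∈T , tt′ , W-chain m t′∈T)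
    ( (S-T-distinct x∈S t∈T ∷ S-T-distinct x∈S t′∈T ∷ All-map x-avoids (W-inner m))
    ∷ (t≢t′ ∷ All-map (T-end-avoids (inj₁ refl)) (W-inner m))
    ∷ (All-map (T-end-avoids (inj₂ refl)) (W-inner m) ∷ W-unique m))
    (W-last m t′)

  length-detour : ∀ m → m < l → Path.len (detour m) ≡ suc (suc (m + m + length exit))
  length-detour m m<l = cong (λ w → suc (suc w)) (begin
    length (zigzag m as bs ++ exit)          ≡⟨ length-++ (zigzag m as bs) ⟩
    length (zigzag m as bs) + length exit    ≡⟨ cong (_+ length exit) (length-zigzag m as bs
                                                  (enough As ≤-refl m m<l) (enough Bs |S|≤|T| m m<l)) ⟩
    m + m + length exit                      ∎)
    where open ≡-Reasoning

  H : Fin (suc l) → Path G x y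
  H fz     = direct
  H (fs i) = detour (toℕ i)

  lengths : ℕ → ℕ
  lengths = ext (λ i → Path.len (H i))

  lengths-1 : lengths 1 ≡ suc (length exit)
  lengths-1 = ext-fromℕ< (λ i → Path.len (H i)) 0 (s≤s z≤n)

  lengths-detour : ∀ m → suc m ≤ l → lengths (suc (suc m)) ≡ suc (suc (m + m + length exit))
  lengths-detour m m<l = begin
    lengths (suc (suc m))                 ≡⟨ ext-fromℕ< (λ i → Path.len (H i)) (suc m) (s≤s m<l) ⟩
    Path.len (detour (toℕ (fromℕ< m<l)))  ≡⟨ cong (λ i → Path.len (detour i)) (toℕ-fromℕ< m<l) ⟩
    Path.len (detour m)                   ≡⟨ length-detour m m<l ⟩
    suc (suc (m + m + length exit))       ∎
    where open ≡-Reasoning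

  -- With l ≥ 1 the lengths are |exit| + 1, |exit| + 2, |exit| + 4, …, so j = 1 works.
  semiLength : 2 ≤ suc l → SemiLength (suc l) H
  semiLength 2≤k = semiLength-at-1 (suc l) lengths 2≤k
    (subst (2 ≤_) (sym lengths-1) (s≤s (s≤s z≤n)))
    (trans (lengths-detour 0 (≤-pred 2≤k)) (trans (+-comm 1 (suc (length exit))) (cong (_+ 1) (sym lengths-1))))
    steps-by-2
    where
    two-more : ∀ m e → suc (suc (suc m + suc m + e)) ≡ suc (suc (m + m + e)) + 2
    two-more = solve-∀
    steps-by-2 : ∀ i → 2 ≤ i → i ≤ l → lengths (suc i) ≡ lengths i + 2
    steps-by-2 (suc (suc m)) (s≤s (s≤s z≤n)) m+2≤l = begin
      lengths (suc (suc (suc m)))                     ≡⟨ lengths-detour (suc m) m+2≤l ⟩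
      suc (suc (suc m + suc m + length exit))         ≡⟨ two-more m (length exit) ⟩
      suc (suc (m + m + length exit)) + 2             ≡⟨ cong (_+ 2) (sym (lengths-detour m (<⇒≤ m+2≤l))) ⟩
      lengths (suc (suc m)) + 2                       ∎
      where open ≡-Reasoning

-- Only (C1), (C2) and the two edge hypotheses are needed here; the 2-connectivity
-- of (G, x, y) and the conditions (C3), (C4) play no role in this case.
lemma2 : ∀ {n : ℕ} (G : Graph n) (k : ℕ) (x y : Fin n) (l : ℕ) (S T : Subset n) →
    1 ≤ k →
    TwoConnRooted G x y →
    IsCore G l S T x y →
    suc l ≡ k →
    Σ (Fin n) (λ s → Σ (Fin n) (λ c →
      s ∈ S × ¬ (s ≡ x) × Reach G (∁ (S ∪ T)) y c × Edge G s c)) →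
    Σ (Fin n) (λ t → Σ (Fin n) (λ t′ → t ∈ T × t′ ∈ T × Edge G t t′)) →
    Σ (Fin k → Path G x y) (λ H → SemiLength k H)
lemma2 G .(suc l) x y l S T _ _ (S∩T=∅ , complete , |S|≡l+1 , 2≤l+1 , |S|≤|T| , x∈S , _) refl
  (s , c , s∈S , s≢x , y⇝c , sc) (t , t′ , t∈T , t′∈T , tt′) =
  H , semiLength 2≤l+1
  where
  open Construction G x y l S T S∩T=∅ complete |S|≡l+1 |S|≤|T| x∈S s c s∈S s≢x y⇝c sc t t′ t∈T t′∈T tt′
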